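{- For any $D(4)$-triple $\{a,b,c\}$ there exists a minimal nonnegative integer $D$ such that $d_{ -(D+1)}(a,b,c)=0$, and this $D$ satisfies $D<\frac{\log(abc)}{\log 5}$.
   Context: A $D(4)$-triple is a set of three distinct positive integers such that the product of any two of them plus $4$ is a perfect square. For a $D(4)$-triple $\{a,b,c\}$ put $$d_{\pm}(a,b,c)=a+b+c+\tfrac12\left(abc\pm\sqrt{(ab+4)(ac+4)(bc+4)}\right)$$ (symmetric in $a,b,c$). A $D(4)$-triple $\{a,b,c\}$ with $a<b<c$ is called regular (Euler) if $c=a+b+2\sqrt{ab+4}$; equivalently $d_-(a,b,c)=0$; for a non-regular triple $d_-(a,b,c)$ is a positive integer and $\{a,b,c,d_-(a,b,c)\}$ is a $D(4)$-quadruple. Define the operator $\partial$ on $D(4)$-triples by $\partial(\{a,b,c\})=\{a,b,c\}$ if $\{a,b,c\}$ is regular, and $\partial(\{a,b,c\})=\{a,b,c,d_-(a,b,c)\}\setminus\{\max(a,b,c)\}$ otherwise. Put $\partial_0(\{a,b,c\})=\{a,b,c\}$, $\partial_{ -D}(\{a,b,c\})=\partial(\partial_{ -(D-1)}(\{a,b,c\}))$ for $D\ge1$, and $d_{ -D}(a,b,c)=d_-(\partial_{ -(D-1)}(\{a,b,c\}))$ for $D\ge 1$. -}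

module Defs where

open import Data.Nat as ℕ using (ℕ; zero; suc; _+_; _*_; _≤?_; _<_; _^_; _≤ᵇ_)
open import Data.Integer as ℤ using (ℤ; +_; ∣_∣)
open import Data.Integer.DivMod using (_/ℕ_)
open import Data.Product using (Σ; _×_; _,_)
open import Data.Bool using (if_then_else_)
open import Relation.Nullary using (¬_; does)
open import Relation.Binary.PropositionalEquality using (_≡_; _≢_)

IsSquare : ℕ → Set
IsSquare n = Σ ℕ λ r → r * r ≡ n

D4Triple : ℕ → ℕ → ℕ → Set
D4Triple a b c =
  (0 < a) × (0 < b) × (0 < c) ×
  (a ≢ b) × (a ≢ c) × (b ≢ c) ×
  IsSquare (a * b + 4) × IsSquare (a * c + 4) × IsSquare (b * c + 4)

isqrtAux : ℕ → ℕ → ℕ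
isqrtAux zero    n = zero
isqrtAux (suc k) n = if (suc k * suc k ≤ᵇ n) then suc k else isqrtAux k n

isqrt : ℕ → ℕ
isqrt n = isqrtAux n n

-- d₋(a,b,c) = a+b+c + (abc - √((ab+4)(ac+4)(bc+4)))/2, as an integer
-- (the numerator 2(a+b+c) + abc - √(...) is even for D(4)-triples, so /2 is exact)
dminus : ℕ → ℕ → ℕ → ℤ
dminus a b c =
  ((+ (2 * (a + b + c) + a * b * c)) ℤ.- (+ isqrt ((a * b + 4) * (a * c + 4) * (b * c + 4)))) /ℕ 2

Triple : Set
Triple = ℕ × ℕ × ℕ

dminusT : Triple → ℤ
dminusT (a , b , c) = dminus a b c

replaceMax : Triple → ℕ → Triple
replaceMax (a , b , c) d =
  if (b ≤ᵇ a) then (if (c ≤ᵇ a) then (d , b , c) else (a , b , d))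
              else (if (c ≤ᵇ b) then (a , d , c) else (a , b , d))

∂ : Triple → Triple
∂ t = if does (dminusT t ℤ.≟ + 0) then t else replaceMax t ∣ dminusT t ∣

∂Iter : ℕ → Triple → Triple
∂Iter zero    t = t
∂Iter (suc D) t = ∂ (∂Iter D t)

-- d_{-D}(a,b,c) for D ≥ 1, indexed so that dIter D t = d_{-(D+1)}(t)
dIter : ℕ → Triple → ℤ
dIter D t = dminusT (∂Iter D t)

module Submission where

-- Write r² = ab+4, s² = ac+4, t² = bc+4, P = rst, σ = 2(a+b+c) + abc and
-- F = (ab+4)(ac+4)(bc+4) = P², so that d₋ = (σ − P)/2.  All arithmetic is in ℕ;
-- ℤ appears only through the definition of d₋.
--  * σ² + 4(16 + 2(ab+ac+bc)) = F + 4(a²+b²+c²), so σ ≡ P (mod 2) and the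
--    division in d₋ is exact.
--  * The gap identity (at − rs)² + 2aP = 2aσ + 16 (and its permutations) shows,
--    when σ = P + 2d, that ad+4 and bd+4 are squares; when P > σ it forces the
--    largest entry c to be ≤ 4, which a finite check rules out.
--  * From the first identity d(P+d) < c² for c maximal, and P ≥ abc with ab ≥ 5
--    gives 5·abd ≤ abc: each step of ∂ divides the product by at least 5.
-- The invariant is a "D(4)-tuple" (a D(4)-triple without distinctness).  The
-- theorem follows by iterating ∂, using the strictly decreasing product as fuel.

open import Defs
open import Data.Nat using (ℕ; _*_; _<_; _^_)
open import Data.Integer using (+_)
open import Data.Product using (Σ; _×_; _,_)
open import Relation.Binary.PropositionalEquality using (_≡_; _≢_)

open import Data.Product using (map; proj₁; proj₂)
open import Data.Nat using (zero; suc; _+_; _∸_; _≤_; z≤n; s≤s; s≤s⁻¹; _≤ᵇ_; _≤?_; ∣_-_∣; parity; >-nonZero)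
open import Data.Nat.Properties
open import Data.Nat.DivMod using (_/_; m*n/n≡m)
open import Data.Nat.Tactic.RingSolver using (solve-∀)
open import Data.Parity.Base using (0ℙ; 1ℙ) renaming (_+_ to _+ℙ_)
import Data.Parity.Properties as ℙ
open import Data.Integer as ℤ using (ℤ; ∣_∣; _/ℕ_)
import Data.Integer.Properties as ℤP
open import Data.Bool using (true; false; T; if_then_else_)
open import Data.Unit using (tt)
open import Data.Empty using (⊥; ⊥-elim)
open import Data.Sum using (_⊎_; inj₁; inj₂)
open import Relation.Nullary using (¬_; yes; no)
open import Relation.Nullary.Decidable using (dec-false)
open import Relation.Binary.PropositionalEquality
  using (refl; sym; trans; cong; cong₂; subst; subst₂; module ≡-Reasoning)


square-<-reflect : ∀ {x y} → x * x < y * y → x < y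
square-<-reflect lt = ≰⇒> λ y≤x → <⇒≱ lt (*-mono-≤ y≤x y≤x)

square-≤-reflect : ∀ {x y} → x * x ≤ y * y → x ≤ y
square-≤-reflect le = ≮⇒≥ λ y<x → <⇒≱ (*-mono-< y<x y<x) le

isqrtAux-root : ∀ k {n m} → m * m ≤ n → n < suc m * suc m → m ≤ k → isqrtAux k n ≡ m
isqrtAux-root zero _ _ z≤n = refl
isqrtAux-root (suc k) {n} {m} lo hi m≤1+k with suc k * suc k ≤ᵇ n in test
... | true  = ≤-antisym (s≤s⁻¹ (square-<-reflect (≤-<-trans (≤ᵇ⇒≤ _ _ k²≤n) hi))) m≤1+k
  where k²≤n : T (suc k * suc k ≤ᵇ n)
        k²≤n = subst T (sym test) tt
... | false = isqrtAux-root k lo hi (s≤s⁻¹ (≤∧≢⇒< m≤1+k m≢1+k))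
  where m≢1+k : m ≢ suc k
        m≢1+k m≡1+k = subst T test (≤⇒≤ᵇ (subst (λ j → j * j ≤ n) m≡1+k lo))

isqrt-square : ∀ m → isqrt (m * m) ≡ m
isqrt-square m = isqrtAux-root (m * m) ≤-refl (*-mono-< (n<1+n m) (n<1+n m)) (m≤m*m m)
  where m≤m*m : ∀ m → m ≤ m * m
        m≤m*m zero    = z≤n
        m≤m*m (suc m) = m≤m*n (suc m) (suc m)

-- On a perfect square isqrt is exact; this lets Agda refute small non-squares.
square-root-exact : ∀ {n} → IsSquare n → isqrt n * isqrt n ≡ n
square-root-exact (r , refl) = cong (λ x → x * x) (isqrt-square r)

even⇒double : ∀ n → parity n ≡ 0ℙ → Σ ℕ λ k → n ≡ 2 * k
even⇒double zero          _    = 0 , refl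
even⇒double (suc zero)    ()
even⇒double (suc (suc n)) even with even⇒double n even
... | k , n≡2k = suc k , trans (cong (λ j → 2 + j) n≡2k) (sym (*-distribˡ-+ 2 1 k))

parity-square-plus-4 : ∀ x m → parity (x * x + 4 * m) ≡ parity x
parity-square-plus-4 x m = begin
  parity (x * x + 4 * m)             ≡⟨ ℙ.+-homo-+ (x * x) (4 * m) ⟩
  parity (x * x) +ℙ parity (4 * m)   ≡⟨ cong₂ _+ℙ_ (trans (ℙ.*-homo-* x x) (ℙ.*-idem (parity x))) (ℙ.*-homo-* 4 m) ⟩
  parity x +ℙ 0ℙ                     ≡⟨ ℙ.+-identityʳ _ ⟩
  parity x                           ∎
  where open ≡-Reasoning

square-congruence : ∀ {x y m n} → x * x + 4 * m ≡ y * y + 4 * n → y ≤ x → Σ ℕ λ k → x ≡ y + 2 * k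
square-congruence {x} {y} {m} {n} eq y≤x =
  let k , x∸y≡2k = even⇒double (x ∸ y) difference-even
  in  k , trans (sym (m+[n∸m]≡n y≤x)) (cong (λ j → y + j) x∸y≡2k)
  where
  open ≡-Reasoning
  cancel : ∀ p q → p +ℙ q ≡ p → q ≡ 0ℙ
  cancel 0ℙ q  p+q≡p = p+q≡p
  cancel 1ℙ 0ℙ _     = refl
  cancel 1ℙ 1ℙ ()
  difference-even : parity (x ∸ y) ≡ 0ℙ
  difference-even = cancel (parity y) _ (begin
    parity y +ℙ parity (x ∸ y)  ≡⟨ ℙ.+-homo-+ y (x ∸ y) ⟨
    parity (y + (x ∸ y))        ≡⟨ cong parity (m+[n∸m]≡n y≤x) ⟩
    parity x                    ≡⟨ parity-square-plus-4 x m ⟨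
    parity (x * x + 4 * m)      ≡⟨ cong parity eq ⟩
    parity (y * y + 4 * n)      ≡⟨ parity-square-plus-4 y n ⟩
    parity y                    ∎)

square-congruence-split : ∀ {x y m n} → x * x + 4 * m ≡ y * y + 4 * n →
  (Σ ℕ λ k → x ≡ y + 2 * k) ⊎ (Σ ℕ λ e → y ≡ x + 2 * suc e)
square-congruence-split {x} {y} {m} {n} eq with y ≤? x
... | yes y≤x = inj₁ (square-congruence {x} {y} {m} {n} eq y≤x)
... | no y≰x with square-congruence {y} {x} {n} {m} (sym eq) (<⇒≤ (≰⇒> y≰x))
...   | zero  , y≡x+0 = ⊥-elim (y≰x (≤-reflexive (trans y≡x+0 (+-identityʳ x))))
...   | suc e , y≡x+2k = inj₂ (e , y≡x+2k)

quarter-square : ∀ {x m} → x * x ≡ 4 * m → IsSquare m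
quarter-square {x} {m} eq with square-congruence {x} {0} {0} {m} (trans (+-identityʳ (x * x)) eq) z≤n
... | k , refl = k , *-cancelˡ-≡ (k * k) m 4 (trans (double-square k) eq)
  where double-square : ∀ k → 4 * (k * k) ≡ (0 + 2 * k) * (0 + 2 * k)
        double-square = solve-∀

-- If ab > 0 and ab + 4 = r² then r ≥ 3, so ab ≥ 5.
product-at-least-5 : ∀ {a b} → 0 < a * b → IsSquare (a * b + 4) → 5 ≤ a * b
product-at-least-5 {a} {b} ab>0 (r , r²) = +-cancelʳ-≤ 4 5 (a * b) (subst (9 ≤_) r² (*-mono-≤ 3≤r 3≤r))
  where 3≤r : 3 ≤ r
        3≤r = ≰⇒> λ r≤2 → <⇒≱ (+-monoˡ-< 4 ab>0) (subst (_≤ 4) r² (*-mono-≤ r≤2 r≤2))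

small-pair : ∀ a b → 0 < a → 0 < b → a ≤ 4 → b ≤ 4 → IsSquare (a * b + 4) → a * b ≡ 12
small-pair 3 4 _ _ _ _ _  = refl
small-pair 4 3 _ _ _ _ _  = refl
small-pair 1 1 _ _ _ _ sq with () ← square-root-exact sq
small-pair 1 2 _ _ _ _ sq with () ← square-root-exact sq
small-pair 1 3 _ _ _ _ sq with () ← square-root-exact sq
small-pair 1 4 _ _ _ _ sq with () ← square-root-exact sq
small-pair 2 1 _ _ _ _ sq with () ← square-root-exact sq
small-pair 2 2 _ _ _ _ sq with () ← square-root-exact sq
small-pair 2 3 _ _ _ _ sq with () ← square-root-exact sq
small-pair 2 4 _ _ _ _ sq with () ← square-root-exact sq
small-pair 3 1 _ _ _ _ sq with () ← square-root-exact sq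
small-pair 3 2 _ _ _ _ sq with () ← square-root-exact sq
small-pair 3 3 _ _ _ _ sq with () ← square-root-exact sq
small-pair 4 1 _ _ _ _ sq with () ← square-root-exact sq
small-pair 4 2 _ _ _ _ sq with () ← square-root-exact sq
small-pair 4 4 _ _ _ _ sq with () ← square-root-exact sq
small-pair 0 _ () _ _ _ _
small-pair (suc _) 0 _ () _ _ _
small-pair (suc (suc (suc (suc (suc _))))) _ _ _ (s≤s (s≤s (s≤s (s≤s ())))) _ _
small-pair (suc _) (suc (suc (suc (suc (suc _))))) _ _ _ (s≤s (s≤s (s≤s (s≤s ())))) _

-- A D(4)-triple with repetitions allowed: positive entries, every pairwise
-- product plus 4 a square.  This is the invariant preserved by ∂.
D4Tuple : Triple → Set
D4Tuple (a , b , c) =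
  (0 < a) × (0 < b) × (0 < c) × IsSquare (a * b + 4) × IsSquare (a * c + 4) × IsSquare (b * c + 4)

twelve-not-square : ¬ IsSquare 12
twelve-not-square sq with () ← square-root-exact sq

-- No D(4)-tuple has all entries ≤ 4: the three products would all be 12,
-- forcing b = c and b² = 12.
no-small-tuple : ∀ {a b c} → D4Tuple (a , b , c) → a ≤ 4 → b ≤ 4 → c ≤ 4 → ⊥
no-small-tuple {a} {b} {c} (pa , pb , pc , sab , sac , sbc) a≤4 b≤4 c≤4 =
  twelve-not-square (b , trans (cong (b *_) b≡c) bc≡12)
  where
  bc≡12 : b * c ≡ 12
  bc≡12 = small-pair b c pb pc b≤4 c≤4 sbc
  b≡c : b ≡ c
  b≡c = *-cancelˡ-≡ b c a {{>-nonZero pa}}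
          (trans (small-pair a b pa pb a≤4 b≤4 sab) (sym (small-pair a c pa pc a≤4 c≤4 sac)))

-- The two ingredients of d₋ = (σ − √F)/2 (this is how dminus unfolds).
σ : ℕ → ℕ → ℕ → ℕ
σ a b c = 2 * (a + b + c) + a * b * c

F : ℕ → ℕ → ℕ → ℕ
F a b c = (a * b + 4) * (a * c + 4) * (b * c + 4)

-- σ and F are symmetric; two transpositions generate all permutations.
σ-swap₁₂ : ∀ a b c → σ a b c ≡ σ b a c
σ-swap₁₂ = expanded
  where expanded : ∀ a b c → 2 * (a + b + c) + a * b * c ≡ 2 * (b + a + c) + b * a * c
        expanded = solve-∀

σ-swap₂₃ : ∀ a b c → σ a b c ≡ σ a c b
σ-swap₂₃ = expanded
  where expanded : ∀ a b c → 2 * (a + b + c) + a * b * c ≡ 2 * (a + c + b) + a * c * b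
        expanded = solve-∀

F-swap₁₂ : ∀ a b c → F a b c ≡ F b a c
F-swap₁₂ = expanded
  where expanded : ∀ a b c → (a * b + 4) * (a * c + 4) * (b * c + 4) ≡ (b * a + 4) * (b * c + 4) * (a * c + 4)
        expanded = solve-∀

F-swap₂₃ : ∀ a b c → F a b c ≡ F a c b
F-swap₂₃ = expanded
  where expanded : ∀ a b c → (a * b + 4) * (a * c + 4) * (b * c + 4) ≡ (a * c + 4) * (a * b + 4) * (c * b + 4)
        expanded = solve-∀

distance-square : ∀ x y → ∣ x - y ∣ * ∣ x - y ∣ + 2 * (x * y) ≡ x * x + y * y
distance-square x y with ≤-total x y
... | inj₁ x≤y with k , refl ← m≤n⇒∃[o]m+o≡n x≤y rewrite ∣m-m+n∣≡n x k = expanded x k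
  where expanded : ∀ x k → k * k + 2 * (x * (x + k)) ≡ x * x + (x + k) * (x + k)
        expanded = solve-∀
... | inj₂ y≤x with k , refl ← m≤n⇒∃[o]m+o≡n y≤x rewrite ∣-∣-comm (y + k) y | ∣m-m+n∣≡n y k = expanded y k
  where expanded : ∀ y k → k * k + 2 * ((y + k) * y) ≡ (y + k) * (y + k) + y * y
        expanded = solve-∀

gap-identity : ∀ x y z p q w → p * p ≡ x * y + 4 → q * q ≡ x * z + 4 → w * w ≡ y * z + 4 →
  ∣ x * w - p * q ∣ * ∣ x * w - p * q ∣ + 2 * x * (p * q * w) ≡ 2 * x * σ x y z + 16
gap-identity x y z p q w p² q² w² = begin
  G * G + 2 * x * (p * q * w)                      ≡⟨ cong (λ v → G * G + v) (regroup x p q w) ⟩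
  G * G + 2 * (x * w * (p * q))                    ≡⟨ distance-square (x * w) (p * q) ⟩
  x * w * (x * w) + p * q * (p * q)                ≡⟨ split-squares x p q w ⟩
  x * x * (w * w) + p * p * (q * q)                ≡⟨ cong₂ (λ u v → x * x * u + v) w² (cong₂ _*_ p² q²) ⟩
  x * x * (y * z + 4) + (x * y + 4) * (x * z + 4)  ≡⟨ expanded x y z ⟩
  2 * x * σ x y z + 16                             ∎
  where
  open ≡-Reasoning
  G : ℕ
  G = ∣ x * w - p * q ∣
  regroup : ∀ x p q w → 2 * x * (p * q * w) ≡ 2 * (x * w * (p * q))
  regroup = solve-∀
  split-squares : ∀ x p q w → x * w * (x * w) + p * q * (p * q) ≡ x * x * (w * w) + p * p * (q * q)
  split-squares = solve-∀
  expanded : ∀ x y z → x * x * (y * z + 4) + (x * y + 4) * (x * z + 4) ≡ 2 * x * (2 * (x + y + z) + x * y * z) + 16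
  expanded = solve-∀

norm-identity : ∀ a b c →
  σ a b c * σ a b c + 4 * (16 + 2 * (a * b + a * c + b * c)) ≡ F a b c + 4 * (c * c + (a * a + b * b))
norm-identity = expanded
  where
  expanded : ∀ a b c →
    (2 * (a + b + c) + a * b * c) * (2 * (a + b + c) + a * b * c) + 4 * (16 + 2 * (a * b + a * c + b * c))
      ≡ (a * b + 4) * (a * c + 4) * (b * c + 4) + 4 * (c * c + (a * a + b * b))
  expanded = solve-∀

gap-with-deficit : ∀ {G x P d} → G + 2 * x * P ≡ 2 * x * (P + 2 * d) + 16 → G ≡ 4 * (x * d + 4)
gap-with-deficit {G} {x} {P} {d} eq = +-cancelʳ-≡ (2 * x * P) G (4 * (x * d + 4)) (trans eq (expanded x P d))
  where expanded : ∀ x P d → 2 * x * (P + 2 * d) + 16 ≡ 4 * (x * d + 4) + 2 * x * P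
        expanded = solve-∀

-- If instead P = σ + 2(e+1), the gap identity leaves 4x(e+1) ≤ 16, so x ≤ 4.
gap-with-excess : ∀ {G x S e} → G + 2 * x * (S + 2 * suc e) ≡ 2 * x * S + 16 → x ≤ 4
gap-with-excess {G} {x} {S} {e} eq = *-cancelˡ-≤ 4 (begin
  4 * x              ≤⟨ m≤m*n (4 * x) (suc e) ⟩
  4 * x * suc e      ≤⟨ m≤n+m (4 * x * suc e) G ⟩
  G + 4 * x * suc e  ≡⟨ +-cancelʳ-≡ (2 * x * S) _ _ (trans (regroup G x S (suc e)) (trans eq (+-comm _ 16))) ⟩
  16                 ∎)
  where
  open ≤-Reasoning
  regroup : ∀ G x S s → G + 4 * x * s + 2 * x * S ≡ G + 2 * x * (S + 2 * s)
  regroup = solve-∀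

deficit-product : ∀ {S P d K L} → S ≡ P + 2 * d → S * S + 4 * K ≡ P * P + 4 * L → d * (P + d) + K ≡ L
deficit-product {P = P} {d} {K} {L} refl eq =
  *-cancelˡ-≡ _ _ 4 (+-cancelˡ-≡ (P * P) _ _ (trans (sym (expanded P d K)) eq))
  where expanded : ∀ P d K → (P + 2 * d) * (P + 2 * d) + 4 * K ≡ P * P + 4 * (d * (P + d) + K)
        expanded = solve-∀

-- With c the largest entry, d(P + d) + 16 + 2(ab+ac+bc) = c² + a² + b² gives dP < c²,
-- because a² + b² ≤ ac + bc ≤ 2(ab + ac + bc).
deficit-bound : ∀ {a b c d P} → a ≤ c → b ≤ c →
  d * (P + d) + (16 + 2 * (a * b + a * c + b * c)) ≡ c * c + (a * a + b * b) → d * P < c * c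
deficit-bound {a} {b} {c} {d} {P} a≤c b≤c eq = +-cancelʳ-≤ M (suc (d * P)) (c * c) (begin
  suc (d * P) + M            ≡⟨ +-suc (d * P) M ⟨
  d * P + (1 + M)            ≤⟨ +-mono-≤ (*-monoʳ-≤ d (m≤m+n P d)) (+-monoˡ-≤ M (s≤s (z≤n {15}))) ⟩
  d * (P + d) + (16 + M)     ≡⟨ eq ⟩
  c * c + (a * a + b * b)    ≤⟨ +-monoʳ-≤ (c * c) squares≤M ⟩
  c * c + M                  ∎)
  where
  open ≤-Reasoning
  M : ℕ
  M = 2 * (a * b + a * c + b * c)
  squares≤M : a * a + b * b ≤ M
  squares≤M = begin
    a * a + b * b              ≤⟨ +-mono-≤ (*-monoʳ-≤ a a≤c) (*-monoʳ-≤ b b≤c) ⟩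
    a * c + b * c              ≤⟨ +-monoˡ-≤ (b * c) (m≤n+m (a * c) (a * b)) ⟩
    a * b + a * c + b * c      ≤⟨ m≤m+n (a * b + a * c + b * c) (1 * (a * b + a * c + b * c)) ⟩
    M                          ∎

shrink : ∀ {a b c d} → 5 ≤ a * b → d * (a * b * c) < c * c → 5 * (a * b * d) ≤ a * b * c
shrink {a} {b} {c} {d} ab≥5 lt = begin
  5 * (a * b * d)        ≤⟨ *-monoˡ-≤ (a * b * d) ab≥5 ⟩
  a * b * (a * b * d)    ≡⟨ cong (a * b *_) (*-comm (a * b) d) ⟩
  a * b * (d * (a * b))  ≤⟨ *-monoʳ-≤ (a * b) (<⇒≤ dab<c) ⟩
  a * b * c              ∎
  where
  open ≤-Reasoning
  dab<c : d * (a * b) < c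
  dab<c = *-cancelʳ-< c (d * (a * b)) c (subst (_< c * c) (sym (*-assoc d (a * b) c)) lt)

halve-difference : ∀ {S P d} → S ≡ P + 2 * d → (+ S ℤ.- + P) /ℕ 2 ≡ + d
halve-difference {P = P} {d} refl = begin
  (+ (P + 2 * d) ℤ.- + P) /ℕ 2  ≡⟨ cong (_/ℕ 2) (trans (ℤP.m-n≡m⊖n _ P) (ℤP.⊖-≥ (m≤m+n P (2 * d)))) ⟩
  + (P + 2 * d ∸ P) /ℕ 2        ≡⟨ cong (λ n → + n /ℕ 2) (m+n∸m≡n P (2 * d)) ⟩
  + (2 * d / 2)                 ≡⟨ cong +_ (trans (cong (_/ 2) (*-comm 2 d)) (m*n/n≡m d 2)) ⟩
  + d                           ∎
  where open ≡-Reasoning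

module Roots {a b c : ℕ} (r s t : ℕ) (r² : r * r ≡ a * b + 4) (s² : s * s ≡ a * c + 4) (t² : t * t ≡ b * c + 4) where

  P : ℕ
  P = r * s * t

  P-squared : P * P ≡ F a b c
  P-squared = trans (regroup r s t) (cong₂ _*_ (cong₂ _*_ r² s²) t²)
    where regroup : ∀ r s t → r * s * t * (r * s * t) ≡ r * r * (s * s) * (t * t)
          regroup = solve-∀

  dminus-via-P : dminus a b c ≡ (+ σ a b c ℤ.- + P) /ℕ 2
  dminus-via-P = cong (λ n → (+ σ a b c ℤ.- + n) /ℕ 2) (trans (cong isqrt (sym P-squared)) (isqrt-square P))

  K L : ℕ
  K = 16 + 2 * (a * b + a * c + b * c)
  L = c * c + (a * a + b * b)

  norm-identity-P : σ a b c * σ a b c + 4 * K ≡ P * P + 4 * L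
  norm-identity-P = trans (norm-identity a b c) (cong (λ n → n + 4 * L) (sym P-squared))

  -- P ≥ abc, since P² = F ≥ (ab)(ac)(bc) = (abc)².
  product≤P : a * b * c ≤ P
  product≤P = square-≤-reflect (begin
    a * b * c * (a * b * c)    ≡⟨ regroup a b c ⟩
    a * b * (a * c) * (b * c)  ≤⟨ *-mono-≤ (*-mono-≤ (m≤m+n (a * b) 4) (m≤m+n (a * c) 4)) (m≤m+n (b * c) 4) ⟩
    F a b c                    ≡⟨ P-squared ⟨
    P * P                      ∎)
    where
    open ≤-Reasoning
    regroup : ∀ a b c → a * b * c * (a * b * c) ≡ a * b * (a * c) * (b * c)
    regroup = solve-∀

  -- σ ≡ P (mod 2) by the norm identity, so either σ = P + 2d or P = σ + 2(e+1).
  σ-vs-P : (Σ ℕ λ d → σ a b c ≡ P + 2 * d) ⊎ (Σ ℕ λ e → P ≡ σ a b c + 2 * suc e)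
  σ-vs-P = square-congruence-split {σ a b c} {P} {K} {L} norm-identity-P

  gap-a : ∣ a * t - r * s ∣ * ∣ a * t - r * s ∣ + 2 * a * P ≡ 2 * a * σ a b c + 16
  gap-a = gap-identity a b c r s t r² s² t²

  gap-b : ∣ b * s - r * t ∣ * ∣ b * s - r * t ∣ + 2 * b * P ≡ 2 * b * σ a b c + 16
  gap-b = begin
    G * G + 2 * b * P            ≡⟨ cong (λ n → G * G + 2 * b * n) (regroup r s t) ⟩
    G * G + 2 * b * (r * t * s)  ≡⟨ gap-identity b a c r t s (trans r² (cong (λ n → n + 4) (*-comm a b))) t² s² ⟩
    2 * b * σ b a c + 16         ≡⟨ cong (λ n → 2 * b * n + 16) (σ-swap₁₂ a b c) ⟨
    2 * b * σ a b c + 16         ∎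
    where
    open ≡-Reasoning
    G : ℕ
    G = ∣ b * s - r * t ∣
    regroup : ∀ r s t → r * s * t ≡ r * t * s
    regroup = solve-∀

  gap-c : ∣ c * r - s * t ∣ * ∣ c * r - s * t ∣ + 2 * c * P ≡ 2 * c * σ a b c + 16
  gap-c = begin
    G * G + 2 * c * P            ≡⟨ cong (λ n → G * G + 2 * c * n) (regroup r s t) ⟩
    G * G + 2 * c * (s * t * r)  ≡⟨ gap-identity c a b s t r (trans s² (cong (λ n → n + 4) (*-comm a c)))
                                                             (trans t² (cong (λ n → n + 4) (*-comm b c))) r² ⟩
    2 * c * σ c a b + 16         ≡⟨ cong (λ n → 2 * c * n + 16) (trans (σ-swap₂₃ a b c) (σ-swap₁₂ a c b)) ⟨
    2 * c * σ a b c + 16         ∎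
    where
    open ≡-Reasoning
    G : ℕ
    G = ∣ c * r - s * t ∣
    regroup : ∀ r s t → r * s * t ≡ s * t * r
    regroup = solve-∀

  Descended : ℤ → Set
  Descended z = D4Tuple (a , b , ∣ z ∣) × (5 * (a * b * ∣ z ∣) ≤ a * b * c)

  -- One descent step at a maximal coordinate c.  P > σ would force c ≤ 4;
  -- d₋ = 0 is excluded; otherwise d₋ = d > 0 gives squares ad + 4, bd + 4
  -- and the product bound.
  descend : 0 < a → 0 < b → 0 < c → a ≤ c → b ≤ c → dminus a b c ≢ + 0 → Descended (dminus a b c)
  descend pa pb pc a≤c b≤c d₋≢0 = by-cases σ-vs-P
    where
    by-cases : (Σ ℕ λ d → σ a b c ≡ P + 2 * d) ⊎ (Σ ℕ λ e → P ≡ σ a b c + 2 * suc e) → Descended (dminus a b c)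
    by-cases (inj₂ (e , P≡σ+)) =
      ⊥-elim (no-small-tuple (pa , pb , pc , (r , r²) , (s , s²) , (t , t²)) (≤-trans a≤c c≤4) (≤-trans b≤c c≤4) c≤4)
      where
      G : ℕ
      G = ∣ c * r - s * t ∣
      c≤4 : c ≤ 4
      c≤4 = gap-with-excess {G * G} {c} {σ a b c} {e}
              (subst (λ n → G * G + 2 * c * n ≡ 2 * c * σ a b c + 16) P≡σ+ gap-c)
    by-cases (inj₁ (zero , σ≡P)) = ⊥-elim (d₋≢0 (trans dminus-via-P (halve-difference σ≡P)))
    by-cases (inj₁ (suc d′ , σ≡P+)) =
      subst Descended (sym (trans dminus-via-P (halve-difference σ≡P+)))
        ( (pa , pb , s≤s z≤n , (r , r²) , new-square a ∣ a * t - r * s ∣ gap-a , new-square b ∣ b * s - r * t ∣ gap-b)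
        , shrink {a} {b} {c} {d} (product-at-least-5 {a} {b} (*-mono-≤ pa pb) (r , r²))
                 (≤-<-trans (*-monoʳ-≤ d product≤P) dP<c²))
      where
      d : ℕ
      d = suc d′
      new-square : ∀ x g → g * g + 2 * x * P ≡ 2 * x * σ a b c + 16 → IsSquare (x * d + 4)
      new-square x g gap =
        quarter-square {g} (gap-with-deficit {g * g} {x} {P} {d} (trans gap (cong (λ n → 2 * x * n + 16) σ≡P+)))
      dP<c² : d * P < c * c
      dP<c² = deficit-bound {a} {b} {c} {d} {P} a≤c b≤c
                (deficit-product {σ a b c} {P} {d} {K} {L} σ≡P+ norm-identity-P)

tuple-swap₁₂ : ∀ {a b c} → D4Tuple (a , b , c) → D4Tuple (b , a , c)
tuple-swap₁₂ {a} {b} (pa , pb , pc , sab , sac , sbc) =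
  pb , pa , pc , subst (λ n → IsSquare (n + 4)) (*-comm a b) sab , sbc , sac

tuple-swap₂₃ : ∀ {a b c} → D4Tuple (a , b , c) → D4Tuple (a , c , b)
tuple-swap₂₃ {b = b} {c} (pa , pb , pc , sab , sac , sbc) =
  pa , pc , pb , sac , sab , subst (λ n → IsSquare (n + 4)) (*-comm b c) sbc

dminus-swap₁₂ : ∀ a b c → dminus a b c ≡ dminus b a c
dminus-swap₁₂ a b c = cong₂ (λ S Φ → (+ S ℤ.- + isqrt Φ) /ℕ 2) (σ-swap₁₂ a b c) (F-swap₁₂ a b c)

dminus-swap₂₃ : ∀ a b c → dminus a b c ≡ dminus a c b
dminus-swap₂₃ a b c = cong₂ (λ S Φ → (+ S ℤ.- + isqrt Φ) /ℕ 2) (σ-swap₂₃ a b c) (F-swap₂₃ a b c)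

prod : Triple → ℕ
prod (a , b , c) = a * b * c

-- Descent at the largest coordinate c.  The value z = d₋(a,b,c) is kept abstract so
-- that the case analysis in replaceMax-descent does not unfold d₋.
descend-max : ∀ {a b c} z → z ≡ dminus a b c → D4Tuple (a , b , c) → a ≤ c → b ≤ c → z ≢ + 0 →
  D4Tuple (a , b , ∣ z ∣) × (5 * (a * b * ∣ z ∣) ≤ a * b * c)
descend-max {a} {b} {c} z z≡d₋ (pa , pb , pc , (r , r²) , (s , s²) , (t , t²)) a≤c b≤c z≢0 =
  subst (Roots.Descended r s t r² s² t²) (sym z≡d₋)
        (Roots.descend r s t r² s² t² pa pb pc a≤c b≤c (λ d₋≡0 → z≢0 (trans z≡d₋ d₋≡0)))

descend-first : ∀ {a b c} z → z ≡ dminus a b c → D4Tuple (a , b , c) → b ≤ a → c ≤ a → z ≢ + 0 →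
  D4Tuple (∣ z ∣ , b , c) × (5 * (∣ z ∣ * b * c) ≤ a * b * c)
descend-first {a} {b} {c} z z≡d₋ g b≤a c≤a z≢0 =
  map (λ g′ → tuple-swap₁₂ (tuple-swap₂₃ g′)) (subst₂ (λ u v → 5 * u ≤ v) (rotate b c ∣ z ∣) (rotate b c a))
      (descend-max z (trans z≡d₋ rotation) (tuple-swap₂₃ (tuple-swap₁₂ g)) b≤a c≤a z≢0)
  where
  rotation : dminus a b c ≡ dminus b c a
  rotation = trans (dminus-swap₁₂ a b c) (dminus-swap₂₃ b a c)
  rotate : ∀ b c x → b * c * x ≡ x * b * c
  rotate = solve-∀

descend-second : ∀ {a b c} z → z ≡ dminus a b c → D4Tuple (a , b , c) → a ≤ b → c ≤ b → z ≢ + 0 →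
  D4Tuple (a , ∣ z ∣ , c) × (5 * (a * ∣ z ∣ * c) ≤ a * b * c)
descend-second {a} {b} {c} z z≡d₋ g a≤b c≤b z≢0 =
  map tuple-swap₂₃ (subst₂ (λ u v → 5 * u ≤ v) (swap a c ∣ z ∣) (swap a c b))
      (descend-max z (trans z≡d₋ (dminus-swap₂₃ a b c)) (tuple-swap₂₃ g) a≤b c≤b z≢0)
  where
  swap : ∀ a c x → a * c * x ≡ a * x * c
  swap = solve-∀

≤ᵇ-true : ∀ {m n} → (m ≤ᵇ n) ≡ true → m ≤ n
≤ᵇ-true {m} {n} holds = ≤ᵇ⇒≤ m n (subst T (sym holds) tt)

≤ᵇ-false : ∀ {m n} → (m ≤ᵇ n) ≡ false → n < m
≤ᵇ-false fails = ≰⇒> λ m≤n → subst T fails (≤⇒≤ᵇ m≤n)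

replaceMax-descent : ∀ a b c z → z ≡ dminus a b c → D4Tuple (a , b , c) → z ≢ + 0 →
  D4Tuple (replaceMax (a , b , c) ∣ z ∣) × (5 * prod (replaceMax (a , b , c) ∣ z ∣) ≤ a * b * c)
replaceMax-descent a b c z z≡d₋ g z≢0 with b ≤ᵇ a in b≤ᵇa | c ≤ᵇ a in c≤ᵇa | c ≤ᵇ b in c≤ᵇb
... | true  | true  | _     = descend-first z z≡d₋ g (≤ᵇ-true b≤ᵇa) (≤ᵇ-true c≤ᵇa) z≢0
... | true  | false | _     =
  descend-max z z≡d₋ g (<⇒≤ (≤ᵇ-false c≤ᵇa)) (≤-trans (≤ᵇ-true b≤ᵇa) (<⇒≤ (≤ᵇ-false c≤ᵇa))) z≢0
... | false | _     | true  = descend-second z z≡d₋ g (<⇒≤ (≤ᵇ-false b≤ᵇa)) (≤ᵇ-true c≤ᵇb) z≢0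
... | false | _     | false =
  descend-max z z≡d₋ g (≤-trans (<⇒≤ (≤ᵇ-false b≤ᵇa)) (<⇒≤ (≤ᵇ-false c≤ᵇb))) (<⇒≤ (≤ᵇ-false c≤ᵇb)) z≢0

∂-nonregular : ∀ t → dminusT t ≢ + 0 → ∂ t ≡ replaceMax t ∣ dminusT t ∣
∂-nonregular t d₋≢0 =
  cong (λ regular → if regular then t else replaceMax t ∣ dminusT t ∣) (dec-false (dminusT t ℤ.≟ + 0) d₋≢0)

∂-step : ∀ t → D4Tuple t → dminusT t ≢ + 0 → D4Tuple (∂ t) × (5 * prod (∂ t) ≤ prod t)
∂-step t@(a , b , c) g d₋≢0 =
  subst (λ u → D4Tuple u × (5 * prod u ≤ prod t)) (sym (∂-nonregular t d₋≢0))
        (replaceMax-descent a b c (dminus a b c) refl g d₋≢0)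

-- A D(4)-tuple has product abc ≥ ab ≥ 5 > 1.
1<prod : ∀ t → D4Tuple t → 1 < prod t
1<prod (a , b , c) (pa , pb , pc , sab , _) =
  ≤-trans (s≤s (s≤s (z≤n {3})))
          (≤-trans (product-at-least-5 {a} {b} (*-mono-≤ pa pb) sab) (m≤m*n (a * b) c {{>-nonZero pc}}))

fifth-below : ∀ {x y} → 0 < x → 5 * x ≤ y → x < y
fifth-below {x} x>0 5x≤y =
  <-≤-trans (subst (x <_) (*-comm x 5) (m<m*n x 5 {{>-nonZero x>0}} (s≤s (s≤s z≤n)))) 5x≤y

∂Iter-shift : ∀ D t → ∂Iter (suc D) t ≡ ∂Iter D (∂ t)
∂Iter-shift zero    t = refl
∂Iter-shift (suc D) t = cong ∂ (∂Iter-shift D t)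

Terminates : Triple → Set
Terminates t = Σ ℕ λ D → (dIter D t ≡ + 0) × ((D′ : ℕ) → D′ < D → dIter D′ t ≢ + 0) × (5 ^ D < prod t)

terminates-after-step : ∀ t → dminusT t ≢ + 0 → 5 * prod (∂ t) ≤ prod t → Terminates (∂ t) → Terminates t
terminates-after-step t d₋≢0 shrinks (D , regular , minimal , bound) =
  suc D , trans (dIter-shift D) regular , minimal′ , <-≤-trans (*-monoʳ-< 5 bound) shrinks
  where
  dIter-shift : ∀ D → dIter (suc D) t ≡ dIter D (∂ t)
  dIter-shift D = cong dminusT (∂Iter-shift D t)
  minimal′ : (D′ : ℕ) → D′ < suc D → dIter D′ t ≢ + 0
  minimal′ zero     _          = d₋≢0
  minimal′ (suc D′) (s≤s D′<D) = λ d₋≡0 → minimal D′ D′<D (trans (sym (dIter-shift D′)) d₋≡0)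

terminates : ∀ n t → D4Tuple t → prod t ≤ n → Terminates t
terminates zero    t g bound = ⊥-elim (<⇒≱ (1<prod t g) (≤-trans bound z≤n))
terminates (suc n) t g bound with dminusT t ℤ.≟ + 0
... | yes regular = 0 , regular , (λ _ ()) , 1<prod t g
... | no d₋≢0 = terminates-after-step t d₋≢0 shrinks (terminates n (∂ t) g′ fuel)
  where
  g′ : D4Tuple (∂ t)
  g′ = proj₁ (∂-step t g d₋≢0)
  shrinks : 5 * prod (∂ t) ≤ prod t
  shrinks = proj₂ (∂-step t g d₋≢0)
  fuel : prod (∂ t) ≤ n
  fuel = s≤s⁻¹ (<-≤-trans (fifth-below (<-trans (s≤s z≤n) (1<prod (∂ t) g′)) shrinks) bound)

proposition4p3 : (a b c : ℕ) → D4Triple a b c →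
    Σ ℕ λ D → (dIter D (a , b , c) ≡ + 0)
      × ((D' : ℕ) → D' < D → dIter D' (a , b , c) ≢ + 0)
      × (5 ^ D < a * b * c)
proposition4p3 a b c (pa , pb , pc , _ , _ , _ , sab , sac , sbc) =
  terminates (a * b * c) (a , b , c) (pa , pb , pc , sab , sac , sbc) ≤-refl
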